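{- Let $m\geq 2$ and $n\geq 3$ be integers with $m\leq n$, and let $G=K_m\square K_n$ with vertices $v_{i,j}$ ($1\le i\le m$, $1\le j\le n$), where $v_{i,j}$ and $v_{i',j'}$ are distinct and adjacent iff $i=i'$ or $j=j'$. Suppose there exists a locating $(n+1)$-coloring of $G$ with colors $\{1,\dots,n+1\}$, and let $C$ be its coloring matrix, the $m\times n$ matrix whose $(i,j)$-entry is the color of $v_{i,j}$. Then different rows of $C$ have different missing colors.
   Context: $K_k$ is the complete graph on $k$ vertices and $\square$ the cartesian product. Since each row of $C$ induces a clique $K_n$, its $n$ entries are distinct colors from $\{1,\dots,n+1\}$; the missing color of a row is the unique color of $\{1,\dots,n+1\}$ not appearing in it. For a connected graph, with $d$ the shortest-path distance and $d(v,S)=\min_{x\in S}d(v,x)$, a proper $k$-coloring (onto $\{1,\dots,k\}$) with color classes $(V_1,\dots,V_k)$ is locating if distinct vertices $v$ have distinct color codes $(d(v,V_1),\dots,d(v,V_k))$. -}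

module Defs where

open import Data.Nat using (ℕ; zero; suc; _≤_)
open import Data.Fin using (Fin)
open import Data.Product using (_×_; _,_; ∃; ∃-syntax)
open import Data.Sum using (_⊎_)
open import Relation.Binary.PropositionalEquality using (_≡_; _≢_)
open import Relation.Nullary using (¬_)

record Graph : Set₁ where
  field
    V   : Set
    Adj : V → V → Set
open Graph public

data Walk (G : Graph) : V G → V G → ℕ → Set where
  nil  : ∀ {u} → Walk G u u 0
  cons : ∀ {u v w k} → Adj G u v → Walk G v w k → Walk G u w (suc k)

DistSet : (G : Graph) → V G → (V G → Set) → ℕ → Set
DistSet G v S k =
  (∃[ w ] (S w × Walk G v w k)) ×
  (∀ w k' → S w → Walk G v w k' → k ≤ k')

Class : (G : Graph) {k : ℕ} → (V G → Fin k) → Fin k → V G → Set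
Class G col c x = col x ≡ c

IsProperOnto : (G : Graph) (k : ℕ) → (V G → Fin k) → Set
IsProperOnto G k col =
  (∀ u v → Adj G u v → col u ≢ col v) × (∀ c → ∃[ v ] col v ≡ c)

SameCode : (G : Graph) {k : ℕ} → (V G → Fin k) → V G → V G → Set
SameCode G {k} col u v =
  ∀ (c : Fin k) → ∃[ d ] (DistSet G u (Class G col c) d × DistSet G v (Class G col c) d)

IsLocating : (G : Graph) (k : ℕ) → (V G → Fin k) → Set
IsLocating G k col =
  IsProperOnto G k col × (∀ u v → SameCode G col u v → u ≡ v)

KmKn : ℕ → ℕ → Graph
KmKn m n = record
  { V   = Fin m × Fin n
  ; Adj = λ { (i , j) (i' , j') → ((i , j) ≢ (i' , j')) × ((i ≡ i') ⊎ (j ≡ j')) } }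

MissingInRow : {m n k : ℕ} → (Fin m × Fin n → Fin k) → Fin m → Fin k → Set
MissingInRow {m} {n} col i c = ∀ (j : Fin n) → col (i , j) ≢ c

-- Each row of the colouring matrix misses exactly one colour, and any two vertices of
-- K_m □ K_n are at distance at most 2, so the colour code of a vertex is determined by
-- its own colour and the set of colours it sees on its row and column.
-- Suppose rows i ≠ i' both miss c, let c sit at (r , s₀) and let x be missed by row r.
-- The rows i and i' contain x in two different columns, one of them some J ≠ s₀; the
-- vertex (r , J) then sees every colour but its own a ≠ c. Rows i and i' contain a,
-- say at (i , p) and (i' , p'). If (i , p) saw c it would see every colour but a, like
-- (r , J), so the two would coincide; hence neither (i , p) nor (i' , p') sees c, both
-- see every other colour but a, and they coincide, i.e. i ≡ i'.
module Submission where

open import Defs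
open import Data.Nat using (ℕ; suc; _≤_; z≤n; s≤s)
open import Data.Nat.Properties using (1+n≰n)
open import Data.Fin using (Fin; punchOut)
open import Data.Fin.Properties using (_≟_; any?; ¬∀⟶∃¬; injective⇒≤; punchOut-injective)
open import Data.Product using (_×_; _,_; proj₁; proj₂; map₂; ∃-syntax)
open import Data.Sum using (_⊎_; inj₁; inj₂)
open import Function using (_∘_)
open import Function.Definitions using (Injective)
open import Relation.Nullary using (¬_; yes; no; contradiction)
open import Relation.Binary.PropositionalEquality using (_≡_; _≢_; refl; sym; trans; cong; subst)

not-all-hit : ∀ {n} (f : Fin n → Fin (suc n)) → ¬ (∀ x → ∃[ j ] f j ≡ x)
not-all-hit f preimage = 1+n≰n (injective⇒≤ preimage-injective)
  where
  preimage-injective : Injective _≡_ _≡_ (proj₁ ∘ preimage)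
  preimage-injective {x} {y} eq =
    trans (sym (proj₂ (preimage x))) (trans (cong f eq) (proj₂ (preimage y)))

misses-some : ∀ {n} (f : Fin n → Fin (suc n)) → ∃[ x ] (∀ j → f j ≢ x)
misses-some {n} f
  with x , ¬hit ← ¬∀⟶∃¬ (suc n) _ (λ x → any? (λ j → f j ≟ x)) (not-all-hit f)
  = x , λ j fj≡x → ¬hit (j , fj≡x)

injective⇒surjective : ∀ {n} {g : Fin n → Fin n} → Injective _≡_ _≡_ g →
                       ∀ y → ∃[ j ] g j ≡ y
injective⇒surjective {suc n} {g} inj y with any? (λ j → g j ≟ y)
... | yes hit = hit
... | no ¬hit = contradiction (injective⇒≤ punched-injective) 1+n≰n
  where
  y≢g : ∀ j → y ≢ g j
  y≢g j y≡gj = ¬hit (j , sym y≡gj)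

  punched-injective : Injective _≡_ _≡_ (λ j → punchOut (y≢g j))
  punched-injective {a} {b} = inj ∘ punchOut-injective (y≢g a) (y≢g b)

injective-hits-all-but-missed : ∀ {n} {f : Fin n → Fin (suc n)} → Injective _≡_ _≡_ f →
                                ∀ {x} → (∀ j → f j ≢ x) → ∀ {e} → e ≢ x → ∃[ j ] f j ≡ e
injective-hits-all-but-missed {f = f} inj {x} missed e≢x =
  map₂ (λ {j} → punchOut-injective (x≢f j) (e≢x ∘ sym))
       (injective⇒surjective punched-injective (punchOut (e≢x ∘ sym)))
  where
  x≢f : ∀ j → x ≢ f j
  x≢f j = missed j ∘ sym

  punched-injective : Injective _≡_ _≡_ (λ j → punchOut (x≢f j))
  punched-injective {a} {b} = inj ∘ punchOut-injective (x≢f a) (x≢f b)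

module Colouring (G : Graph) {k : ℕ} (col : V G → Fin k) where

  Sees : V G → Fin k → Set
  Sees v e = ∃[ w ] (Adj G v w × col w ≡ e)

  distance-zero : ∀ {v e} → col v ≡ e → DistSet G v (Class G col e) 0
  distance-zero {v} cv≡e = (v , cv≡e , nil) , λ _ _ _ _ → z≤n

  distance-one : ∀ {v e} → col v ≢ e → Sees v e → DistSet G v (Class G col e) 1
  distance-one {v} {e} cv≢e (w , v~w , cw≡e) = (w , cw≡e , cons v~w nil) , shortest
    where
    shortest : ∀ w' k' → Class G col e w' → Walk G v w' k' → 1 ≤ k'
    shortest _ _ cv≡e nil        = contradiction cv≡e cv≢e
    shortest _ _ _    (cons _ _) = s≤s z≤n

  distance-two : ∀ {v w e} → col v ≢ e → ¬ Sees v e → Walk G v w 2 → col w ≡ e →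
                 DistSet G v (Class G col e) 2
  distance-two {v} {w} {e} cv≢e ¬sees walk cw≡e = (w , cw≡e , walk) , shortest
    where
    shortest : ∀ w' k' → Class G col e w' → Walk G v w' k' → 2 ≤ k'
    shortest _ _ cv≡e  nil                 = contradiction cv≡e cv≢e
    shortest w' _ cw'≡e (cons v~w' nil)     = contradiction (w' , v~w' , cw'≡e) ¬sees
    shortest _ _ _     (cons _ (cons _ _)) = s≤s (s≤s z≤n)

  ColoursWithinTwo : Set
  ColoursWithinTwo = ∀ v e → col v ≢ e → ¬ Sees v e → ∃[ w ] (Walk G v w 2 × col w ≡ e)

  SeeAlike : V G → V G → Set
  SeeAlike u v = ∀ e → e ≢ col u → (Sees u e × Sees v e) ⊎ (¬ Sees u e × ¬ Sees v e)

  unseen-distance-two : ColoursWithinTwo → ∀ {v e} → col v ≢ e → ¬ Sees v e →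
                        DistSet G v (Class G col e) 2
  unseen-distance-two withinTwo {v} {e} cv≢e ¬sees
    with w , walk , cw≡e ← withinTwo v e cv≢e ¬sees = distance-two cv≢e ¬sees walk cw≡e

  sameCode-of-seeAlike : ColoursWithinTwo → ∀ {u v} → col u ≡ col v → SeeAlike u v →
                         SameCode G col u v
  sameCode-of-seeAlike withinTwo {u} {v} cu≡cv alike e with e ≟ col u
  ... | yes refl = 0 , distance-zero refl , distance-zero (sym cu≡cv)
  ... | no e≢cu = same-distance (alike e e≢cu)
    where
    cu≢e : col u ≢ e
    cu≢e = e≢cu ∘ sym

    cv≢e : col v ≢ e
    cv≢e cv≡e = cu≢e (trans cu≡cv cv≡e)

    same-distance : (Sees u e × Sees v e) ⊎ (¬ Sees u e × ¬ Sees v e) →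
                    ∃[ d ] (DistSet G u (Class G col e) d × DistSet G v (Class G col e) d)
    same-distance (inj₁ (sees-u , sees-v)) =
      1 , distance-one cu≢e sees-u , distance-one cv≢e sees-v
    same-distance (inj₂ (¬sees-u , ¬sees-v)) =
      2 , unseen-distance-two withinTwo cu≢e ¬sees-u , unseen-distance-two withinTwo cv≢e ¬sees-v

module Rook {m n k : ℕ} (col : Fin m × Fin n → Fin k) where
  open Colouring (KmKn m n) col public

  adjacent-of-colour≢ : ∀ {i j i' j'} → col (i , j) ≢ col (i' , j') → i ≡ i' ⊎ j ≡ j' →
                        Adj (KmKn m n) (i , j) (i' , j')
  adjacent-of-colour≢ c≢c' line = c≢c' ∘ cong col , line

  sees-in-row : ∀ {i j j' e} → col (i , j') ≡ e → col (i , j) ≢ e → Sees (i , j) e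
  sees-in-row {i} {j' = j'} c'≡e c≢e =
    (i , j') , adjacent-of-colour≢ (λ c≡c' → c≢e (trans c≡c' c'≡e)) (inj₁ refl) , c'≡e

  sees-in-column : ∀ {i i' j e} → col (i' , j) ≡ e → col (i , j) ≢ e → Sees (i , j) e
  sees-in-column {i' = i'} {j = j} c'≡e c≢e =
    (i' , j) , adjacent-of-colour≢ (λ c≡c' → c≢e (trans c≡c' c'≡e)) (inj₂ refl) , c'≡e

  colours-within-two : (∀ e → ∃[ v ] col v ≡ e) → ColoursWithinTwo
  colours-within-two onto (i , p) e cv≢e ¬sees
    with (r , s) , crs≡e ← onto e =
    (r , s) , cons (s≢p ∘ sym ∘ cong proj₂ , inj₁ refl)
                   (cons (r≢i ∘ sym ∘ cong proj₁ , inj₂ refl) nil) , crs≡e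
    where
    r≢i : r ≢ i
    r≢i refl = ¬sees (sees-in-row crs≡e cv≢e)
    s≢p : s ≢ p
    s≢p refl = ¬sees (sees-in-column crs≡e cv≢e)

  module Locating (loc : IsLocating (KmKn m n) k col) where
    proper : ∀ u v → Adj (KmKn m n) u v → col u ≢ col v
    proper = proj₁ (proj₁ loc)

    onto : ∀ e → ∃[ v ] col v ≡ e
    onto = proj₂ (proj₁ loc)

    ≡-of-seeAlike : ∀ {u v} → col u ≡ col v → SeeAlike u v → u ≡ v
    ≡-of-seeAlike cu≡cv alike =
      proj₂ loc _ _ (sameCode-of-seeAlike (colours-within-two onto) cu≡cv alike)

    Full : Fin m × Fin n → Set
    Full v = ∀ e → e ≢ col v → Sees v e

    full-unique : ∀ {u v} → Full u → Full v → col u ≡ col v → u ≡ v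
    full-unique full-u full-v cu≡cv = ≡-of-seeAlike cu≡cv λ e e≢cu →
      inj₁ (full-u e e≢cu , full-v e λ e≡cv → e≢cu (trans e≡cv (sym cu≡cv)))

    row-injective : ∀ i → Injective _≡_ _≡_ (λ j → col (i , j))
    row-injective i {j} {j'} c≡c' with j ≟ j'
    ... | yes j≡j' = j≡j'
    ... | no  j≢j' = contradiction c≡c' (proper _ _ ((j≢j' ∘ cong proj₂) , inj₁ refl))

    column-distinct : ∀ {i i' j j'} → i ≢ i' → col (i , j) ≡ col (i' , j') → j ≢ j'
    column-distinct i≢i' c≡c' refl =
      proper _ _ ((i≢i' ∘ cong proj₁) , inj₂ refl) c≡c'

module MissingColours {m n : ℕ} (col : Fin m × Fin n → Fin (suc n))
                      (loc : IsLocating (KmKn m n) (suc n) col) where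
  open Rook col public
  open Locating loc public

  row-contains : ∀ {i x} → MissingInRow col i x → ∀ {e} → e ≢ x → ∃[ j ] col (i , j) ≡ e
  row-contains {i} = injective-hits-all-but-missed (row-injective i)

  sees-row-colours : ∀ {i x} → MissingInRow col i x → ∀ {p e} → e ≢ x →
                     e ≢ col (i , p) → Sees (i , p) e
  sees-row-colours missed e≢x e≢c with j , c≡e ← row-contains missed e≢x =
    sees-in-row c≡e (e≢c ∘ sym)

  full-if-sees-missing : ∀ {ι c p} → MissingInRow col ι c → Sees (ι , p) c → Full (ι , p)
  full-if-sees-missing {c = c} missed sees e e≢own with e ≟ c
  ... | yes refl = sees
  ... | no  e≢c  = sees-row-colours missed e≢c e≢own

  full-in-column-of-missing : ∀ {r x} → MissingInRow col r x → ∀ {K J} → col (K , J) ≡ x →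
                              Full (r , J)
  full-in-column-of-missing {x = x} missed cKJ≡x e e≢own with e ≟ x
  ... | yes refl = sees-in-column cKJ≡x (missed _)
  ... | no  e≢x  = sees-row-colours missed e≢x e≢own

  full-vertex-avoiding : ∀ {i i' j j' r x} → i ≢ i' → col (i , j) ≡ x → col (i' , j') ≡ x →
                         MissingInRow col r x → ∀ s₀ → ∃[ J ] (J ≢ s₀ × Full (r , J))
  full-vertex-avoiding {j = j} {j'} i≢i' cj≡x cj'≡x missed s₀
    with j ≟ s₀ | column-distinct i≢i' (trans cj≡x (sym cj'≡x))
  ... | yes refl | j≢j' = j' , j≢j' ∘ sym , full-in-column-of-missing missed cj'≡x
  ... | no  j≢s₀ | _    = j  , j≢s₀      , full-in-column-of-missing missed cj≡x

  ¬sees-missing : ∀ {ι c v} → MissingInRow col ι c → Full v → ¬ MissingInRow col (proj₁ v) c →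
                  ∀ {p} → col (ι , p) ≡ col v → ¬ Sees (ι , p) c
  ¬sees-missing {c = c} missed full-v v-row-has-c cp≡cv sees =
    v-row-has-c (subst (λ ι → MissingInRow col ι c)
                       (cong proj₁ (full-unique (full-if-sees-missing missed sees) full-v cp≡cv))
                       missed)

  ≡-of-full-vertex : ∀ {i i' c v} → MissingInRow col i c → MissingInRow col i' c →
                     col v ≢ c → Full v → ¬ MissingInRow col (proj₁ v) c → i ≡ i'
  ≡-of-full-vertex {i} {i'} {c} {v} missedᵢ missedᵢ' cv≢c full-v v-row-has-c
    with p , cp≡cv ← row-contains missedᵢ cv≢c | p' , cp'≡cv ← row-contains missedᵢ' cv≢c =
    cong proj₁ (≡-of-seeAlike (trans cp≡cv (sym cp'≡cv)) alike)
    where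
    alike : SeeAlike (i , p) (i' , p')
    alike e e≢cp with e ≟ c
    ... | yes refl = inj₂ ( ¬sees-missing missedᵢ full-v v-row-has-c cp≡cv
                          , ¬sees-missing missedᵢ' full-v v-row-has-c cp'≡cv)
    ... | no e≢c = inj₁ ( sees-row-colours missedᵢ e≢c e≢cp
                        , sees-row-colours missedᵢ' e≢c e≢cp')
      where
      e≢cp' : e ≢ col (i' , p')
      e≢cp' e≡cp' = e≢cp (trans e≡cp' (trans cp'≡cv (sym cp≡cv)))

lemma2 : (m n : ℕ) → 2 ≤ m → 3 ≤ n → m ≤ n →
    (col : Fin m × Fin n → Fin (suc n)) →
    IsLocating (KmKn m n) (suc n) col →
    (i i' : Fin m) (c : Fin (suc n)) →
    MissingInRow col i c → MissingInRow col i' c → i ≡ i'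
lemma2 m n _ _ _ col loc i i' c missedᵢ missedᵢ' with i ≟ i'
... | yes i≡i' = i≡i'
... | no  i≢i' =
  let (r , s₀) , cr≡c  = onto c
      x , missedʳ      = misses-some (λ j → col (r , j))
      x≢c              = λ x≡c → missedʳ s₀ (trans cr≡c (sym x≡c))
      j  , cj≡x        = row-contains missedᵢ x≢c
      j' , cj'≡x       = row-contains missedᵢ' x≢c
      J , J≢s₀ , full  = full-vertex-avoiding i≢i' cj≡x cj'≡x missedʳ s₀
      cJ≢c             = λ cJ≡c → J≢s₀ (row-injective r (trans cJ≡c (sym cr≡c)))
  in ≡-of-full-vertex missedᵢ missedᵢ' cJ≢c full (λ missedʳ-c → missedʳ-c s₀ cr≡c)
  where open MissingColours col loc
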